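{- Let $k\geq 0$ be an integer. The maximum number of edges in a cylindrical semi-bar $k$-visibility graph with $n$ vertices is $(k+1)(2n-2k-3)$ for $n \geq 2k+2$ and $\binom{n}{2}$ for $n \leq 2k+2$.
   Context: A cylindrical semi-bar $k$-visibility representation of a graph $G=(V,E)$ is a collection $\{s_v\}_{v\in V}$ of pairwise disjoint segments (semi-bars) in $\mathbb{R}^3$ parallel to the $x$-axis with left endpoints on the circle $\{(0,y,z): y^2+z^2=1\}$, such that for all $a,b\in V$, $\{a,b\}\in E$ if and only if there is a circular arc on the surface of the cylinder $y^2+z^2=1$ lying in a plane parallel to the $yz$-plane (a sightline) which intersects $s_a$, $s_b$, and at most $k$ other semi-bars. A graph is a cylindrical semi-bar $k$-visibility graph if it has such a representation.
   Formalization: The angles and lengths of the semi-bars, and the heights and arcs of the sightlines, are rational rather than real. -}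

module Defs where

open import Data.Nat as ℕ using (ℕ)
open import Data.Fin using (Fin; toℕ)
open import Data.Fin.Properties using () renaming (_≟_ to _≟ᶠ_)
open import Data.Rational as ℚ using (ℚ; 0ℚ; 1ℚ)
open import Data.Bool using (Bool; true; false; _∧_; not; if_then_else_)
open import Data.List using (List; length; filterᵇ; allFin; concatMap; map)
open import Data.Product using (Σ; _×_; ∃)
open import Relation.Binary.PropositionalEquality using (_≡_; _≢_)
open import Relation.Nullary.Decidable using (⌊_⌋)
open import Function.Bundles using (_⇔_)

-- A point of the unit circle {(0,y,z) : y²+z²=1} is parametrised by its
-- angle t ∈ [0,1) (the point (0, cos 2πt, sin 2πt)).  Only the cyclic order
-- of the points and the order of the bar lengths matter.

-- A cylindrical semi-bar representation of a graph on vertex set Fin n: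
-- semi-bar s_v is the segment from (0, cos 2πθ_v, sin 2πθ_v) to
-- (L_v, cos 2πθ_v, sin 2πθ_v), parallel to the x-axis, left endpoint on the
-- circle.  Pairwise disjointness ⇔ distinct angles.
record SemiBarRep (n : ℕ) : Set where
  field
    angle      : Fin n → ℚ
    len        : Fin n → ℚ
    angle-nonneg : ∀ v → 0ℚ ℚ.≤ angle v
    angle-lt1    : ∀ v → angle v ℚ.< 1ℚ
    angle-inj    : ∀ u v → angle u ≡ angle v → u ≡ v
    len-pos      : ∀ v → 0ℚ ℚ.< len v

-- A sightline: a (closed, proper) circular arc on the cylinder lying in the
-- plane x = height, going counterclockwise from angle `start` through an
-- angular span `span` (in full turns, 0 ≤ span < 1).
record Sightline : Set where
  field
    height : ℚ
    start  : ℚ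
    span   : ℚ
    start-nonneg : 0ℚ ℚ.≤ start
    start-lt1    : start ℚ.< 1ℚ
    span-nonneg  : 0ℚ ℚ.≤ span
    span-lt1     : span ℚ.< 1ℚ

onArc : ℚ → ℚ → ℚ → Bool
onArc α β θ =
  if ⌊ α ℚ.≤? θ ⌋ then ⌊ θ ℚ.- α ℚ.≤? β ⌋ else ⌊ (θ ℚ.- α) ℚ.+ 1ℚ ℚ.≤? β ⌋

hits : ∀ {n} → SemiBarRep n → Sightline → Fin n → Bool
hits R s v =
  ⌊ 0ℚ ℚ.≤? Sightline.height s ⌋ ∧ ⌊ Sightline.height s ℚ.≤? SemiBarRep.len R v ⌋
  ∧ onArc (Sightline.start s) (Sightline.span s) (SemiBarRep.angle R v)

othersHit : ∀ {n} → SemiBarRep n → Sightline → Fin n → Fin n → ℕ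
othersHit {n} R s a b =
  length (filterᵇ (λ v → hits R s v ∧ not ⌊ v ≟ᶠ a ⌋ ∧ not ⌊ v ≟ᶠ b ⌋) (allFin n))

Sees : ∀ {n} → ℕ → SemiBarRep n → Fin n → Fin n → Set
Sees k R a b = Σ Sightline λ s →
  (hits R s a ≡ true) × (hits R s b ≡ true) × (othersHit R s a b ℕ.≤ k)

record SimpleGraph (n : ℕ) : Set where
  field
    adj     : Fin n → Fin n → Bool
    adj-sym : ∀ u v → adj u v ≡ adj v u
    adj-irr : ∀ v → adj v v ≡ false

numEdges : ∀ {n} → SimpleGraph n → ℕ
numEdges {n} G = length (filterᵇ (λ p → p)
  (concatMap (λ i → map (λ j → ⌊ toℕ i ℕ.<? toℕ j ⌋ ∧ SimpleGraph.adj G i j) (allFin n))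
             (allFin n)))

IsCSBVisGraph : ∀ {n} → ℕ → SimpleGraph n → Set
IsCSBVisGraph {n} k G = Σ (SemiBarRep n) λ R →
  ∀ a b → a ≢ b → (SimpleGraph.adj G a b ≡ true) ⇔ Sees k R a b

IsMaxEdges : ℕ → ℕ → ℕ → Set
IsMaxEdges k n m =
  (∀ (G : SimpleGraph n) → IsCSBVisGraph k G → numEdges G ℕ.≤ m)
  × (Σ (SimpleGraph n) λ G → IsCSBVisGraph k G × (numEdges G ≡ m))

module Submission where

-- Order the bars by length, longest first, and charge each edge to its shorter endpoint v.
-- A sightline meeting s_v lies at height at most |s_v|, so it meets every longer bar whose
-- angle lies on its arc. That arc contains one of the two circular intervals between v and
-- the other endpoint u, so at most k longer bars lie strictly between v and u on that side:
-- u is among the first k+1 longer bars counterclockwise or clockwise from v. The r-th longest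
-- bar therefore has at most min(r, 2k+2) longer neighbours, and Σ_{r<n} min(r, 2k+2) is the
-- stated bound. When the lengths are distinct, the sightline at height |s_v| along the
-- interval from v to such a bar meets only the bars in between, so every representation with
-- distinct lengths attains the bound.

open import Defs
open import Data.Bool as Bool using (Bool; true; false; T; not; _∧_; if_then_else_)
open import Data.Bool.Properties using (T?; T-≡)
open import Data.Empty using (⊥-elim)
open import Data.Fin using (Fin; zero; suc; toℕ)
open import Data.Fin.Induction using (spo-noetherian)
open import Data.Fin.Properties as Fin using (_≟_; any?; toℕ-injective)
open import Data.List using (List; length; filterᵇ; tabulate; concatMap; map; allFin; _++_)
open import Data.List.Properties using (filter-++; length-++; map-tabulate)
open import Data.Nat as ℕ using (ℕ; zero; suc)
open import Data.Nat.Combinatorics using (_C_; nC1≡n; nCk+nC[k+1]≡[n+1]C[k+1])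
import Data.Nat.Properties as ℕ
open import Algebra.Properties.CommutativeMonoid.Sum ℕ.+-0-commutativeMonoid
  using (sum; sum-cong-≗; sum-replicate-zero; ∑-distrib-+; ∑-comm)
import Data.Nat.Solver as ℕ-Solver
open import Data.Product using (∃; ∃-syntax; _×_; _,_; proj₁; proj₂)
open import Data.Product.Relation.Binary.Lex.Strict using (×-Lex; ×-isStrictPartialOrder; ×-decidable)
open import Data.Rational as ℚ using (ℚ; 0ℚ; 1ℚ; ½)
import Data.Rational.Properties as ℚ
open import Algebra.Properties.Group ℚ.+-0-group using (∙-cancelˡ; ∙-cancelʳ)
open import Data.Sum using (_⊎_; inj₁; inj₂)
open import Data.Unit using (tt)
open import Function using (_∘_; _on_; flip; id; _⇔_; mk⇔; Equivalence)
open import Induction.WellFounded using (Acc; acc)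
open import Level using (Level; 0ℓ)
open import Relation.Binary using (Rel; Asymmetric; IsStrictPartialOrder; tri<; tri≈; tri>)
import Relation.Binary as B
import Relation.Binary.Construct.On as On
import Relation.Binary.Construct.Flip.EqAndOrd as Flip
open import Relation.Binary.PropositionalEquality
  using (_≡_; _≢_; refl; sym; trans; cong; cong₂; subst; subst₂; module ≡-Reasoning)
open import Relation.Nullary using (¬_; Dec; yes; no; does; ¬?; _×-dec_; _⊎-dec_; ofʸ; ofⁿ)
open import Relation.Nullary.Decidable using (⌊_⌋; toWitness; fromWitness; from-yes)
open import Relation.Unary using (Pred; Decidable; _⊆_; _≐_)
open import Relation.Unary.Properties using (_∩?_; _∪?_)

open Equivalence using (to; from)

module Circle where

  open import Data.Rational using (_+_; _-_; -_; _*_; _≤_; _<_; _≤?_; _<?_)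
  open import Data.Rational.Properties
    using (≤-refl; ≤-reflexive; ≤-trans; <-trans; <⇒≤; <-≤-trans; ≤-<-trans; <-irrefl; <-cmp; ≰⇒>;
           +-monoʳ-≤; +-monoˡ-≤; +-monoʳ-<; +-monoˡ-<)
  open import Data.Rational.Solver using (module +-*-Solver)
  open +-*-Solver

  p≤p+q : ∀ p {q} → 0ℚ ≤ q → p ≤ p + q
  p≤p+q p {q} 0≤q = subst (_≤ p + q) (ℚ.+-identityʳ p) (+-monoʳ-≤ p 0≤q)

  +-cancelˡ-< : ∀ p {q r} → p + q < p + r → q < r
  +-cancelˡ-< p {q} {r} p+q<p+r = subst₂ _<_ (cancel q) (cancel r) (+-monoʳ-< (- p) p+q<p+r)
    where
    cancel : ∀ s → - p + (p + s) ≡ s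
    cancel = solve 2 (λ p s → (:- p) :+ (p :+ s) := s) refl p

  0≤q-p : ∀ {p q} → p ≤ q → 0ℚ ≤ q - p
  0≤q-p {p} {q} p≤q = subst (_≤ q - p) (ℚ.+-inverseʳ p) (+-monoˡ-≤ (- p) p≤q)

  q-p<0 : ∀ {p q} → q < p → q - p < 0ℚ
  q-p<0 {p} {q} q<p = subst (q - p <_) (ℚ.+-inverseʳ p) (+-monoˡ-< (- p) q<p)

  q-p≤q : ∀ {p q} → 0ℚ ≤ p → q - p ≤ q
  q-p≤q {p} {q} 0≤p = subst (q - p ≤_) (ℚ.+-identityʳ q) (+-monoʳ-≤ q (ℚ.neg-antimono-≤ 0≤p))

  q-p+1≡1+q-p : ∀ q p → (q - p) + 1ℚ ≡ (1ℚ + q) - p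
  q-p+1≡1+q-p = solve 2 (λ q p → (q :- p) :+ con 1ℚ := (con 1ℚ :+ q) :- p) refl

  0≤1 : 0ℚ ≤ 1ℚ
  0≤1 = from-yes (0ℚ ≤? 1ℚ)

  record Angle : Set where
    field
      value    : ℚ
      0≤value  : 0ℚ ≤ value
      value<1  : value < 1ℚ

  open Angle

  offset : Angle → Angle → ℚ
  offset x y = if ⌊ value x ≤? value y ⌋ then value y - value x else (value y - value x) + 1ℚ

  onArc-offset : ∀ (x y : Angle) β → onArc (value x) β (value y) ≡ ⌊ offset x y ≤? β ⌋
  onArc-offset x y β with value x ≤? value y
  ... | yes _ = refl
  ... | no  _ = refl

  offset-cases : ∀ x y → (value x ≤ value y × offset x y ≡ value y - value x)
                       ⊎ (value y < value x × offset x y ≡ (value y - value x) + 1ℚ)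
  offset-cases x y with value x ≤? value y
  ... | yes x≤y = inj₁ (x≤y , refl)
  ... | no  x≰y = inj₂ (≰⇒> x≰y , refl)

  offset-nonneg : ∀ x y → 0ℚ ≤ offset x y
  offset-nonneg x y with offset-cases x y
  ... | inj₁ (x≤y , eq) = subst (0ℚ ≤_) (sym eq) (0≤q-p x≤y)
  ... | inj₂ (y<x , eq) = subst (0ℚ ≤_) (sym (trans eq (q-p+1≡1+q-p (value y) (value x))))
                                (0≤q-p (<⇒≤ (<-≤-trans (value<1 x) (p≤p+q 1ℚ (0≤value y)))))

  offset<1 : ∀ x y → offset x y < 1ℚ
  offset<1 x y with offset-cases x y
  ... | inj₁ (x≤y , eq) = subst (_< 1ℚ) (sym eq) (≤-<-trans (q-p≤q (0≤value x)) (value<1 y))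
  ... | inj₂ (y<x , eq) = subst (_< 1ℚ) (sym eq) (+-monoˡ-< 1ℚ (q-p<0 y<x))

  offset-self : ∀ x → offset x x ≡ 0ℚ
  offset-self x with offset-cases x x
  ... | inj₁ (_ , eq)   = trans eq (ℚ.+-inverseʳ (value x))
  ... | inj₂ (x<x , _)  = ⊥-elim (<-irrefl refl x<x)

  y-x≢z-x+1 : ∀ x y z → value y - value x ≢ (value z - value x) + 1ℚ
  y-x≢z-x+1 x y z eq = <-irrefl y≡1+z (<-≤-trans (value<1 y) (p≤p+q 1ℚ (0≤value z)))
    where
    y≡1+z : value y ≡ 1ℚ + value z
    y≡1+z = ∙-cancelʳ (- value x) _ _ (trans eq (q-p+1≡1+q-p (value z) (value x)))

  offset-injective : ∀ x y z → offset x y ≡ offset x z → value y ≡ value z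
  offset-injective x y z eq with offset-cases x y | offset-cases x z
  ... | inj₁ (_ , ey) | inj₁ (_ , ez) = ∙-cancelʳ (- value x) _ _ (trans (sym ey) (trans eq ez))
  ... | inj₂ (_ , ey) | inj₂ (_ , ez) = ∙-cancelʳ (- value x) _ _ (∙-cancelʳ 1ℚ _ _ (trans (sym ey) (trans eq ez)))
  ... | inj₁ (_ , ey) | inj₂ (_ , ez) = ⊥-elim (y-x≢z-x+1 x y z (trans (sym ey) (trans eq ez)))
  ... | inj₂ (_ , ey) | inj₁ (_ , ez) = ⊥-elim (y-x≢z-x+1 x z y (trans (sym ez) (trans (sym eq) ey)))

  module _ (x y z : Angle) where
    private
      p = value x
      q = value y
      r = value z
      via : ∀ {a b c A B C : ℚ} → a ≡ A → b ≡ B → c ≡ C → A + B ≡ C → a + b ≡ c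
      via refl refl refl eq = eq
      I₁ : (q - p) + (r - q) ≡ r - p
      I₁ = solve 3 (λ p q r → (q :- p) :+ (r :- q) := r :- p) refl p q r
      I₂ : (q - p) + ((r - q) + 1ℚ) ≡ (r - p) + 1ℚ
      I₂ = solve 3 (λ p q r → (q :- p) :+ ((r :- q) :+ con 1ℚ) := (r :- p) :+ con 1ℚ) refl p q r
      I₃ : ((q - p) + 1ℚ) + (r - q) ≡ (r - p) + 1ℚ
      I₃ = solve 3 (λ p q r → ((q :- p) :+ con 1ℚ) :+ (r :- q) := (r :- p) :+ con 1ℚ) refl p q r
      I₄ : ((q - p) + 1ℚ) + ((r - q) + 1ℚ) ≡ ((r - p) + 1ℚ) + 1ℚ
      I₄ = solve 3 (λ p q r → ((q :- p) :+ con 1ℚ) :+ ((r :- q) :+ con 1ℚ) := ((r :- p) :+ con 1ℚ) :+ con 1ℚ) refl p q r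

    offset-cocycle : offset x y + offset y z ≡ offset x z
                   ⊎ offset x y + offset y z ≡ offset x z + 1ℚ
    offset-cocycle with offset-cases x y | offset-cases y z | offset-cases x z
    ... | inj₁ (_ , xy) | inj₁ (_ , yz) | inj₁ (_ , xz) = inj₁ (via xy yz xz I₁)
    ... | inj₁ (_ , xy) | inj₂ (_ , yz) | inj₁ (_ , xz) = inj₂ (via xy yz (cong (_+ 1ℚ) xz) I₂)
    ... | inj₁ (_ , xy) | inj₂ (_ , yz) | inj₂ (_ , xz) = inj₁ (via xy yz xz I₂)
    ... | inj₂ (_ , xy) | inj₁ (_ , yz) | inj₁ (_ , xz) = inj₂ (via xy yz (cong (_+ 1ℚ) xz) I₃)
    ... | inj₂ (_ , xy) | inj₁ (_ , yz) | inj₂ (_ , xz) = inj₁ (via xy yz xz I₃)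
    ... | inj₂ (_ , xy) | inj₂ (_ , yz) | inj₂ (_ , xz) = inj₂ (via xy yz (cong (_+ 1ℚ) xz) I₄)
    ... | inj₁ (x≤y , _) | inj₁ (y≤z , _) | inj₂ (z<x , _) = ⊥-elim (<-irrefl refl (≤-<-trans (≤-trans x≤y y≤z) z<x))
    ... | inj₂ (y<x , _) | inj₂ (z<y , _) | inj₁ (x≤z , _) = ⊥-elim (<-irrefl refl (<-≤-trans (<-trans z<y y<x) x≤z))

  offset-triangle : ∀ x y z → offset x z ≤ offset x y + offset y z
  offset-triangle x y z with offset-cocycle x y z
  ... | inj₁ eq = ≤-reflexive (sym eq)
  ... | inj₂ eq = subst (offset x z ≤_) (sym eq) (p≤p+q (offset x z) 0≤1)

  offset-additive : ∀ x y z → offset x y ≤ offset x z → offset x y + offset y z ≡ offset x z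
  offset-additive x y z xy≤xz with offset-cocycle x y z
  ... | inj₁ eq = eq
  ... | inj₂ eq = ⊥-elim (<-irrefl eq (<-≤-trans (+-monoʳ-< (offset x y) (offset<1 y z)) (+-monoˡ-≤ 1ℚ xy≤xz)))

  offset-pos : ∀ x y → value x ≢ value y → 0ℚ < offset x y
  offset-pos x y x≢y with <-cmp 0ℚ (offset x y)
  ... | tri< 0<xy _ _ = 0<xy
  ... | tri≈ _ 0≡xy _ = ⊥-elim (x≢y (offset-injective x x y (trans (offset-self x) 0≡xy)))
  ... | tri> _ _ xy<0 = ⊥-elim (<-irrefl refl (<-≤-trans xy<0 (offset-nonneg x y)))

  offset-flip : ∀ x y → value x ≢ value y → offset x y + offset y x ≡ 1ℚ
  offset-flip x y x≢y with offset-cocycle x y x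
  ... | inj₁ eq = ⊥-elim (<-irrefl (sym (trans eq (offset-self x)))
                    (<-≤-trans (offset-pos x y x≢y) (p≤p+q (offset x y) (offset-nonneg y x))))
  ... | inj₂ eq = trans eq (cong (_+ 1ℚ) (offset-self x))

  offset-rotate : ∀ x y z → value x ≢ value y → offset x y < offset x z → offset y z < offset y x
  offset-rotate x y z x≢y xy<xz = +-cancelˡ-< (offset x y) (begin-strict
    offset x y + offset y z  ≡⟨ offset-additive x y z (<⇒≤ xy<xz) ⟩
    offset x z               <⟨ offset<1 x z ⟩
    1ℚ                       ≡⟨ offset-flip x y x≢y ⟨
    offset x y + offset y x  ∎)
    where open ℚ.≤-Reasoning

  offset-between : ∀ a x y w → offset a x ≤ offset a y → offset x w ≤ offset x y → offset a w ≤ offset a y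
  offset-between a x y w ax≤ay xw≤xy = begin
    offset a w               ≤⟨ offset-triangle a x w ⟩
    offset a x + offset x w  ≤⟨ +-monoʳ-≤ (offset a x) xw≤xy ⟩
    offset a x + offset x y  ≡⟨ offset-additive a x y ax≤ay ⟩
    offset a y               ∎
    where open ℚ.≤-Reasoning

  ≤∧≢⇒< : ∀ {p q} → p ≤ q → p ≢ q → p < q
  ≤∧≢⇒< {p} {q} p≤q p≢q with <-cmp p q
  ... | tri< p<q _ _ = p<q
  ... | tri≈ _ p≡q _ = ⊥-elim (p≢q p≡q)
  ... | tri> _ _ q<p = ⊥-elim (<-irrefl refl (≤-<-trans p≤q q<p))

  halfway : ℕ → ℚ
  halfway zero    = 0ℚ
  halfway (suc m) = ½ * (halfway m + 1ℚ)

  0<1 : 0ℚ < 1ℚ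
  0<1 = from-yes (0ℚ <? 1ℚ)

  halfway<1 : ∀ m → halfway m < 1ℚ
  halfway<1 zero    = 0<1
  halfway<1 (suc m) = ℚ.*-monoʳ-<-pos ½ (+-monoˡ-< 1ℚ (halfway<1 m))

  halfway-nonneg : ∀ m → 0ℚ ≤ halfway m
  halfway-nonneg zero    = ≤-refl
  halfway-nonneg (suc m) = ℚ.*-monoˡ-≤-nonNeg ½ (≤-trans (halfway-nonneg m) (p≤p+q (halfway m) 0≤1))

  halfway-step : ∀ m → halfway m < halfway (suc m)
  halfway-step m = subst (_< halfway (suc m)) (half-double (halfway m))
                         (ℚ.*-monoʳ-<-pos ½ (+-monoʳ-< (halfway m) (halfway<1 m)))
    where
    half-double : ∀ x → ½ * (x + x) ≡ x
    half-double = solve 1 (λ x → con ½ :* (x :+ x) := x) refl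

  halfway-mono : ∀ {a b} → a ℕ.< b → halfway a < halfway b
  halfway-mono {a} {suc b} a<1+b with ℕ.m≤n⇒m<n∨m≡n (ℕ.s≤s⁻¹ a<1+b)
  ... | inj₁ a<b  = <-trans (halfway-mono a<b) (halfway-step b)
  ... | inj₂ refl = halfway-step a

  halfway-injective : ∀ a b → halfway a ≡ halfway b → a ≡ b
  halfway-injective a b eq with ℕ.<-cmp a b
  ... | tri< a<b _ _ = ⊥-elim (<-irrefl eq (halfway-mono a<b))
  ... | tri≈ _ a≡b _ = a≡b
  ... | tri> _ _ b<a = ⊥-elim (<-irrefl (sym eq) (halfway-mono b<a))

open Circle
open Angle

-- Opened only here, so that the arithmetic in Circle is that of ℚ.
open import Data.Nat using (_+_; _*_; _∸_; _⊓_; _≤_; _<_; _≥_; z≤n; s≤s)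

private variable
  n : ℕ
  p q : Level

-- Counting in Fin n

sum-mono-≤ : {f g : Fin n → ℕ} → (∀ i → f i ≤ g i) → sum f ≤ sum g
sum-mono-≤ {zero}  f≤g = z≤n
sum-mono-≤ {suc n} f≤g = ℕ.+-mono-≤ (f≤g zero) (sum-mono-≤ (f≤g ∘ suc))

sumOver : {P : Pred (Fin n) p} → Decidable P → (Fin n → ℕ) → ℕ
sumOver P? f = sum (λ i → if does (P? i) then f i else 0)

count : {P : Pred (Fin n) p} → Decidable P → ℕ
count P? = sumOver P? (λ _ → 1)

_∖?_ : {P : Pred (Fin n) p} → Decidable P → (m : Fin n) → Decidable (λ i → i ≢ m × P i)
(P? ∖? m) i = ¬? (i ≟ m) ×-dec P? i

sumOver-cong : {P : Pred (Fin n) p} (P? : Decidable P) {f g : Fin n → ℕ} → (∀ {i} → P i → f i ≡ g i) →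
               sumOver P? f ≡ sumOver P? g
sumOver-cong P? {f} {g} f≡g = sum-cong-≗ pointwise
  where
  pointwise : ∀ i → (if does (P? i) then f i else 0) ≡ (if does (P? i) then g i else 0)
  pointwise i with P? i
  ... | yes Pi = f≡g Pi
  ... | no  _  = refl

sumOver-empty : {P : Pred (Fin n) p} (P? : Decidable P) (f : Fin n → ℕ) → (∀ {i} → ¬ P i) → sumOver P? f ≡ 0
sumOver-empty {n = n} P? f P-empty = trans (sum-cong-≗ vanish) (sum-replicate-zero n)
  where
  vanish : ∀ i → (if does (P? i) then f i else 0) ≡ 0
  vanish i with P? i
  ... | yes Pi = ⊥-elim (P-empty Pi)
  ... | no  _  = refl

sumOver-remove : {P : Pred (Fin n) p} (P? : Decidable P) (f : Fin n → ℕ) {m : Fin n} → P m →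
                 sumOver P? f ≡ sumOver (P? ∖? m) f + f m
sumOver-remove P? f {zero} Pm with P? zero
... | yes _   = ℕ.+-comm (f zero) _
... | no  ¬Pm = ⊥-elim (¬Pm Pm)
sumOver-remove P? f {suc m} Pm =
  trans (cong (head +_) (sumOver-remove (P? ∘ suc) (f ∘ suc) Pm)) (sym (ℕ.+-assoc head rest (f (suc m))))
  where
  head rest : ℕ
  head = if does (P? zero) then f zero else 0
  rest = sumOver ((P? ∘ suc) ∖? m) (f ∘ suc)

count-remove : {P : Pred (Fin n) p} (P? : Decidable P) {m : Fin n} → P m → count P? ≡ suc (count (P? ∖? m))
count-remove P? Pm = trans (sumOver-remove P? _ Pm) (ℕ.+-comm _ 1)

count-mono : {P : Pred (Fin n) p} {Q : Pred (Fin n) q} (P? : Decidable P) (Q? : Decidable Q) → P ⊆ Q → count P? ≤ count Q?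
count-mono P? Q? P⊆Q = sum-mono-≤ pointwise
  where
  pointwise : ∀ i → (if does (P? i) then 1 else 0) ≤ (if does (Q? i) then 1 else 0)
  pointwise i with P? i | Q? i
  ... | yes _  | yes _  = ℕ.≤-refl
  ... | yes Pi | no ¬Qi = ⊥-elim (¬Qi (P⊆Q Pi))
  ... | no  _  | _      = z≤n

count-cong : {P : Pred (Fin n) p} {Q : Pred (Fin n) q} (P? : Decidable P) (Q? : Decidable Q) → P ≐ Q → count P? ≡ count Q?
count-cong P? Q? (P⊆Q , Q⊆P) = ℕ.≤-antisym (count-mono P? Q? P⊆Q) (count-mono Q? P? Q⊆P)

≐-from-⇔ : {P : Pred (Fin n) p} {Q : Pred (Fin n) q} → (∀ {i} → P i ⇔ Q i) → P ≐ Q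
≐-from-⇔ P⇔Q = (λ {i} → to (P⇔Q {i})) , (λ {i} → from (P⇔Q {i}))

count-all : count {n = n} (λ _ → yes tt) ≡ n
count-all {zero}  = refl
count-all {suc n} = cong suc (count-all {n})

count-nonempty : {P : Pred (Fin n) p} (P? : Decidable P) → 0 < count P? → ∃ P
count-nonempty P? 0<count with any? P?
... | yes witness = witness
... | no  none    = ⊥-elim (ℕ.<⇒≢ 0<count (sym (sumOver-empty P? _ (λ {i} Pi → none (i , Pi)))))

count-∩ : {P : Pred (Fin n) p} {Q : Pred (Fin n) q} (P? : Decidable P) (Q? : Decidable Q) →
          count (P? ∩? Q?) ≡ sumOver P? (λ i → if does (Q? i) then 1 else 0)
count-∩ P? Q? = sum-cong-≗ pointwise
  where
  pointwise : ∀ i → (if does ((P? ∩? Q?) i) then 1 else 0) ≡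
                    (if does (P? i) then (if does (Q? i) then 1 else 0) else 0)
  pointwise i with P? i
  ... | yes _ = refl
  ... | no  _ = refl

count-∪-∩ : {P : Pred (Fin n) p} {Q : Pred (Fin n) q} (P? : Decidable P) (Q? : Decidable Q) →
            count (P? ∪? Q?) + count (P? ∩? Q?) ≡ count P? + count Q?
count-∪-∩ P? Q? = begin
  count (P? ∪? Q?) + count (P? ∩? Q?)  ≡⟨ ∑-distrib-+ (ind (P? ∪? Q?)) (ind (P? ∩? Q?)) ⟨
  sum (λ i → ind (P? ∪? Q?) i + ind (P? ∩? Q?) i) ≡⟨ sum-cong-≗ pointwise ⟩
  sum (λ i → ind P? i + ind Q? i)     ≡⟨ ∑-distrib-+ (ind P?) (ind Q?) ⟩
  count P? + count Q?                 ∎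
  where
  open ≡-Reasoning
  ind : ∀ {r} {R : Pred (Fin _) r} → Decidable R → Fin _ → ℕ
  ind R? i = if does (R? i) then 1 else 0
  pointwise : ∀ i → ind (P? ∪? Q?) i + ind (P? ∩? Q?) i ≡ ind P? i + ind Q? i
  pointwise i with P? i | Q? i
  ... | yes _ | yes _ = refl
  ... | yes _ | no  _ = refl
  ... | no  _ | yes _ = refl
  ... | no  _ | no  _ = refl

count-∪-disjoint : {P : Pred (Fin n) p} {Q : Pred (Fin n) q} (P? : Decidable P) (Q? : Decidable Q) →
                   (∀ {i} → ¬ (P i × Q i)) → count (P? ∪? Q?) ≡ count P? + count Q?
count-∪-disjoint P? Q? disjoint = begin
  count (P? ∪? Q?)                      ≡⟨ ℕ.+-identityʳ _ ⟨
  count (P? ∪? Q?) + 0                  ≡⟨ cong (count (P? ∪? Q?) +_) (sumOver-empty (P? ∩? Q?) _ disjoint) ⟨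
  count (P? ∪? Q?) + count (P? ∩? Q?)   ≡⟨ count-∪-∩ P? Q? ⟩
  count P? + count Q?                   ∎
  where open ≡-Reasoning

-- Ranks in a strict order

sumBelow : ℕ → (ℕ → ℕ) → ℕ
sumBelow zero    h = 0
sumBelow (suc N) h = sumBelow N h + h N

module Ranking {n ℓ₁ ℓ₂} {_≈_ : Rel (Fin n) ℓ₁} {_⊏_ : Rel (Fin n) ℓ₂}
               (⊏-spo : IsStrictPartialOrder _≈_ _⊏_) (_⊏?_ : B.Decidable _⊏_) where

  open IsStrictPartialOrder ⊏-spo using (asym) renaming (irrefl to irrefl≈)

  irrefl : ∀ {x} → ¬ x ⊏ x
  irrefl = irrefl≈ (IsStrictPartialOrder.Eq.refl ⊏-spo)

  TotalOn : Pred (Fin n) p → Set _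
  TotalOn P = ∀ {x y} → P x → P y → x ≢ y → x ⊏ y ⊎ y ⊏ x

  rank : {P : Pred (Fin n) p} → Decidable P → Fin n → ℕ
  rank P? u = count (λ w → P? w ×-dec (w ⊏? u))

  maximum : {P : Pred (Fin n) p} → Decidable P → TotalOn P → ∀ {x} → P x →
            ∃[ m ] P m × (∀ {u} → P u → u ≢ m → u ⊏ m)
  maximum {P = P} P? total {x} Px = climb Px (spo-noetherian ⊏-spo x)
    where
    climb : ∀ {x} → P x → Acc (flip _⊏_) x → ∃[ m ] P m × (∀ {u} → P u → u ≢ m → u ⊏ m)
    climb {x} Px (acc above) with any? (λ w → P? w ×-dec (x ⊏? w))
    ... | yes (w , Pw , x⊏w) = climb Pw (above x⊏w)
    ... | no  nothing-above  = x , Px , below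
      where
      below : ∀ {u} → P u → u ≢ x → u ⊏ x
      below {u} Pu u≢x with total Pu Px u≢x
      ... | inj₁ u⊏x = u⊏x
      ... | inj₂ x⊏u = ⊥-elim (nothing-above (u , Pu , x⊏u))

  -- By induction on |P|: the ⊏-maximum of P has rank |P| - 1, and removing it leaves
  -- the other ranks unchanged.
  sumOver-rank : {P : Pred (Fin n) p} (P? : Decidable P) → TotalOn P → ∀ h →
                 sumOver P? (h ∘ rank P?) ≡ sumBelow (count P?) h
  sumOver-rank P? total h = by-size (count P?) P? total refl
    where
    by-size : ∀ N {P : Pred (Fin n) p} (P? : Decidable P) → TotalOn P → count P? ≡ N →
              sumOver P? (h ∘ rank P?) ≡ sumBelow N h
    by-size zero P? _ #P≡0 = sumOver-empty P? (h ∘ rank P?) λ Pi →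
      ℕ.1+n≢0 (trans (sym (count-remove P? Pi)) #P≡0)
    by-size (suc N) {P = P} P? total #P≡1+N
      with x , Px ← count-nonempty P? (subst (0 <_) (sym #P≡1+N) (s≤s z≤n))
      with m , Pm , below ← maximum P? total Px = begin
        sumOver P? (h ∘ rank P?)                        ≡⟨ sumOver-remove P? (h ∘ rank P?) Pm ⟩
        sumOver P?∖m (h ∘ rank P?) + h (rank P? m)     ≡⟨ cong₂ _+_ (sumOver-cong P?∖m rank-below-max) (cong h rank-max) ⟩
        sumOver P?∖m (h ∘ rank P?∖m) + h N             ≡⟨ cong (_+ h N) (by-size N P?∖m total′ #P∖m≡N) ⟩
        sumBelow N h + h N                             ∎
      where
      open ≡-Reasoning
      P?∖m = P? ∖? m
      total′ : TotalOn (λ i → i ≢ m × P i)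
      total′ (_ , Px) (_ , Py) = total Px Py
      #P∖m≡N : count P?∖m ≡ N
      #P∖m≡N = ℕ.suc-injective (trans (sym (count-remove P? Pm)) #P≡1+N)
      rank-max : rank P? m ≡ N
      rank-max = trans (count-cong (λ w → P? w ×-dec (w ⊏? m)) P?∖m
        ( (λ (Pw , w⊏m) → (λ { refl → irrefl w⊏m }) , Pw)
        , (λ (w≢m , Pw) → Pw , below Pw w≢m))) #P∖m≡N
      rank-below-max : ∀ {u} → u ≢ m × P u → h (rank P? u) ≡ h (rank P?∖m u)
      rank-below-max {u} (u≢m , Pu) = cong h (count-cong (λ w → P? w ×-dec (w ⊏? u)) (λ w → P?∖m w ×-dec (w ⊏? u))
        ( (λ (Pw , w⊏u) → ((λ { refl → asym (below Pu u≢m) w⊏u }) , Pw) , w⊏u)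
        , (λ ((_ , Pw) , w⊏u) → Pw , w⊏u)))

  corank : {P : Pred (Fin n) p} → Decidable P → Fin n → ℕ
  corank P? u = count (λ w → P? w ×-dec (u ⊏? w))

  rank+corank : {P : Pred (Fin n) p} (P? : Decidable P) → TotalOn P → ∀ {u} → P u →
                count P? ≡ suc (rank P? u + corank P? u)
  rank+corank {P = P} P? total {u} Pu = begin
    count P?                     ≡⟨ count-remove P? Pu ⟩
    suc (count (P? ∖? u))        ≡⟨ cong suc (count-cong (P? ∖? u) (before ∪? after) (split , merge)) ⟩
    suc (count (before ∪? after)) ≡⟨ cong suc (count-∪-disjoint before after (λ ((_ , w⊏u) , (_ , u⊏w)) → asym w⊏u u⊏w)) ⟩
    suc (rank P? u + corank P? u) ∎
    where
    open ≡-Reasoning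
    before after : Decidable _
    before w = P? w ×-dec (w ⊏? u)
    after  w = P? w ×-dec (u ⊏? w)
    split : ∀ {w} → w ≢ u × P w → (P w × w ⊏ u) ⊎ (P w × u ⊏ w)
    split (w≢u , Pw) with total Pw Pu w≢u
    ... | inj₁ w⊏u = inj₁ (Pw , w⊏u)
    ... | inj₂ u⊏w = inj₂ (Pw , u⊏w)
    merge : ∀ {w} → (P w × w ⊏ u) ⊎ (P w × u ⊏ w) → w ≢ u × P w
    merge (inj₁ (Pw , w⊏u)) = (λ { refl → irrefl w⊏u }) , Pw
    merge (inj₂ (Pw , u⊏w)) = (λ { refl → irrefl u⊏w }) , Pw

-- Sums of minima

sumBelow-indicator-≤ : ∀ k N → sumBelow N (λ r → if r ℕ.≤ᵇ k then 1 else 0) ≡ N ⊓ suc k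
sumBelow-indicator-≤ k zero    = refl
sumBelow-indicator-≤ k (suc N) with N ℕ.≤ᵇ k | ℕ.≤ᵇ-reflects-≤ N k
... | true | ofʸ N≤k = begin
  sumBelow N _ + 1  ≡⟨ cong (_+ 1) (sumBelow-indicator-≤ k N) ⟩
  N ⊓ suc k + 1     ≡⟨ cong (_+ 1) (ℕ.m≤n⇒m⊓n≡m (ℕ.m≤n⇒m≤1+n N≤k)) ⟩
  N + 1             ≡⟨ ℕ.+-comm N 1 ⟩
  suc N             ≡⟨ ℕ.m≤n⇒m⊓n≡m (s≤s N≤k) ⟨
  suc N ⊓ suc k     ∎
  where open ≡-Reasoning
... | false | ofⁿ N≰k = begin
  sumBelow N _ + 0  ≡⟨ ℕ.+-identityʳ _ ⟩
  sumBelow N _      ≡⟨ sumBelow-indicator-≤ k N ⟩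
  N ⊓ suc k         ≡⟨ ℕ.m≥n⇒m⊓n≡n (ℕ.≰⇒> N≰k) ⟩
  suc k             ≡⟨ ℕ.m≥n⇒m⊓n≡n (ℕ.m≤n⇒m≤1+n (ℕ.≰⇒> N≰k)) ⟨
  suc N ⊓ suc k     ∎
  where open ≡-Reasoning

[1+n]C2 : ∀ n → suc n C 2 ≡ n C 2 + n
[1+n]C2 n = trans (sym (nCk+nC[k+1]≡[n+1]C[k+1] n 1)) (trans (cong (_+ n C 2) (nC1≡n n)) (ℕ.+-comm n (n C 2)))

2*[1+n]C2 : ∀ n → 2 * (suc n C 2) ≡ suc n * n
2*[1+n]C2 zero    = refl
2*[1+n]C2 (suc n) = begin
  2 * (suc (suc n) C 2)         ≡⟨ cong (2 *_) ([1+n]C2 (suc n)) ⟩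
  2 * (suc n C 2 + suc n)       ≡⟨ ℕ.*-distribˡ-+ 2 (suc n C 2) (suc n) ⟩
  2 * (suc n C 2) + 2 * suc n   ≡⟨ cong (_+ 2 * suc n) (2*[1+n]C2 n) ⟩
  suc n * n + 2 * suc n         ≡⟨ solve 1 (λ n → (con 1 :+ n) :* n :+ con 2 :* (con 1 :+ n) := (con 2 :+ n) :* (con 1 :+ n)) refl n ⟩
  suc (suc n) * suc n           ∎
  where
  open ≡-Reasoning
  open ℕ-Solver.+-*-Solver

[2k+2]C2 : ∀ k → (2 * k + 2) C 2 ≡ (k + 1) * (2 * k + 1)
[2k+2]C2 k = ℕ.*-cancelˡ-≡ _ _ 2 (begin
  2 * ((2 * k + 2) C 2)          ≡⟨ cong (λ N → 2 * (N C 2)) (ℕ.+-suc (2 * k) 1) ⟩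
  2 * (suc (2 * k + 1) C 2)      ≡⟨ 2*[1+n]C2 (2 * k + 1) ⟩
  suc (2 * k + 1) * (2 * k + 1)  ≡⟨ solve 1 (λ k → (con 1 :+ (con 2 :* k :+ con 1)) :* (con 2 :* k :+ con 1)
                                               := con 2 :* ((k :+ con 1) :* (con 2 :* k :+ con 1))) refl k ⟩
  2 * ((k + 1) * (2 * k + 1))    ∎)
  where
  open ≡-Reasoning
  open ℕ-Solver.+-*-Solver

sumBelow-⊓-≤ : ∀ {c} N → N ≤ c → sumBelow N (_⊓ c) ≡ N C 2
sumBelow-⊓-≤ zero    _   = refl
sumBelow-⊓-≤ (suc N) N<c = begin
  sumBelow N (_⊓ _) + N ⊓ _  ≡⟨ cong₂ _+_ (sumBelow-⊓-≤ N (ℕ.<⇒≤ N<c)) (ℕ.m≤n⇒m⊓n≡m (ℕ.<⇒≤ N<c)) ⟩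
  N C 2 + N                  ≡⟨ [1+n]C2 N ⟨
  suc N C 2                  ∎
  where open ≡-Reasoning

sumBelow-⊓-+ : ∀ c m → sumBelow (c + m) (_⊓ c) ≡ sumBelow c (_⊓ c) + m * c
sumBelow-⊓-+ c zero    = trans (cong (λ N → sumBelow N (_⊓ c)) (ℕ.+-identityʳ c)) (sym (ℕ.+-identityʳ _))
sumBelow-⊓-+ c (suc m) = begin
  sumBelow (c + suc m) (_⊓ c)              ≡⟨ cong (λ N → sumBelow N (_⊓ c)) (ℕ.+-suc c m) ⟩
  sumBelow (c + m) (_⊓ c) + (c + m) ⊓ c    ≡⟨ cong₂ _+_ (sumBelow-⊓-+ c m) (ℕ.m≥n⇒m⊓n≡n (ℕ.m≤m+n c m)) ⟩
  sumBelow c (_⊓ c) + m * c + c            ≡⟨ ℕ.+-assoc (sumBelow c (_⊓ c)) (m * c) c ⟩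
  sumBelow c (_⊓ c) + (m * c + c)          ≡⟨ cong (sumBelow c (_⊓ c) +_) (ℕ.+-comm (m * c) c) ⟩
  sumBelow c (_⊓ c) + suc m * c            ∎
  where open ≡-Reasoning

-- The r-th longest bar has at most min(r, 2k+2) longer neighbours.
maxEdges : ℕ → ℕ → ℕ
maxEdges k n = sumBelow n (_⊓ (2 * k + 2))

maxEdges-≤ : ∀ k n → n ≤ 2 * k + 2 → maxEdges k n ≡ n C 2
maxEdges-≤ k n = sumBelow-⊓-≤ n

maxEdges-≥ : ∀ k n → n ≥ 2 * k + 2 → maxEdges k n ≡ (k + 1) * (2 * n ∸ (2 * k + 3))
maxEdges-≥ k n n≥c = begin
  maxEdges k n                               ≡⟨ cong (maxEdges k) c+m≡n ⟨
  sumBelow (c + m) (_⊓ c)                    ≡⟨ sumBelow-⊓-+ c m ⟩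
  sumBelow c (_⊓ c) + m * c                  ≡⟨ cong (_+ m * c) (trans (sumBelow-⊓-≤ c ℕ.≤-refl) ([2k+2]C2 k)) ⟩
  (k + 1) * (2 * k + 1) + m * c              ≡⟨ solve 2 (λ k m → (k :+ con 1) :* (con 2 :* k :+ con 1) :+ m :* (con 2 :* k :+ con 2)
                                                           := (k :+ con 1) :* (con 2 :* m :+ con 2 :* k :+ con 1)) refl k m ⟩
  (k + 1) * d                                ≡⟨ cong ((k + 1) *_) (ℕ.m+n∸n≡m d (2 * k + 3)) ⟨
  (k + 1) * (d + (2 * k + 3) ∸ (2 * k + 3))  ≡⟨ cong (λ x → (k + 1) * (x ∸ (2 * k + 3))) d+2k+3≡2n ⟩
  (k + 1) * (2 * n ∸ (2 * k + 3))            ∎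
  where
  open ≡-Reasoning
  open ℕ-Solver.+-*-Solver
  c = 2 * k + 2
  m = n ∸ c
  d = 2 * m + 2 * k + 1
  c+m≡n : c + m ≡ n
  c+m≡n = ℕ.m+[n∸m]≡n n≥c
  d+2k+3≡2n : d + (2 * k + 3) ≡ 2 * n
  d+2k+3≡2n = trans (solve 2 (λ k m → (con 2 :* m :+ con 2 :* k :+ con 1) :+ (con 2 :* k :+ con 3)
                                    := con 2 :* ((con 2 :* k :+ con 2) :+ m)) refl k m)
                    (cong (2 *_) c+m≡n)

2*k+2≡2+[k+k] : ∀ k → 2 * k + 2 ≡ 2 + (k + k)
2*k+2≡2+[k+k] = solve 1 (λ k → con 2 :* k :+ con 2 := con 2 :+ (k :+ k)) refl
  where open ℕ-Solver.+-*-Solver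

1+k+[1+k]≡2*k+2 : ∀ k → suc k + suc k ≡ 2 * k + 2
1+k+[1+k]≡2*k+2 = solve 1 (λ k → (con 1 :+ k) :+ (con 1 :+ k) := con 2 :* k :+ con 2) refl
  where open ℕ-Solver.+-*-Solver

m+n≤o+o⇒m≤o⊎n≤o : ∀ {m n} o → m + n ≤ o + o → m ≤ o ⊎ n ≤ o
m+n≤o+o⇒m≤o⊎n≤o {m} {n} o m+n≤o+o with m ℕ.≤? o
... | yes m≤o = inj₁ m≤o
... | no  m≰o = inj₂ (ℕ.<⇒≤ (ℕ.+-cancelˡ-< o n o (ℕ.<-≤-trans (ℕ.+-monoˡ-< n (ℕ.≰⇒> m≰o)) m+n≤o+o)))

-- Counting edges through an orientation

length-filterᵇ-tabulate : ∀ {A : Set} (p : A → Bool) (f : Fin n → A) →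
                          length (filterᵇ p (tabulate f)) ≡ count (T? ∘ p ∘ f)
length-filterᵇ-tabulate {zero}  p f = refl
length-filterᵇ-tabulate {suc n} p f with p (f zero)
... | true  = cong suc (length-filterᵇ-tabulate p (f ∘ suc))
... | false = length-filterᵇ-tabulate p (f ∘ suc)

length-filterᵇ-concatMap : ∀ {A B : Set} (p : B → Bool) (g : A → List B) (f : Fin n → A) →
  length (filterᵇ p (concatMap g (tabulate f))) ≡ sum (λ i → length (filterᵇ p (g (f i))))
length-filterᵇ-concatMap {zero}  p g f = refl
length-filterᵇ-concatMap {suc n} p g f = begin
  length (filterᵇ p (g (f zero) ++ rest))                    ≡⟨ cong length (filter-++ (T? ∘ p) (g (f zero)) rest) ⟩
  length (filterᵇ p (g (f zero)) ++ filterᵇ p rest)          ≡⟨ length-++ (filterᵇ p (g (f zero))) ⟩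
  length (filterᵇ p (g (f zero))) + length (filterᵇ p rest) ≡⟨ cong (length (filterᵇ p (g (f zero))) +_)
                                                                   (length-filterᵇ-concatMap p g (f ∘ suc)) ⟩
  sum (λ i → length (filterᵇ p (g (f i))))                  ∎
  where
  open ≡-Reasoning
  rest = concatMap g (tabulate (f ∘ suc))

T-⌊⌋∧ : ∀ {a} {A : Set a} (a? : Dec A) (b : Bool) → T (⌊ a? ⌋ ∧ b) ⇔ (A × b ≡ true)
T-⌊⌋∧ (yes a) true  = mk⇔ (λ _ → a , refl) _
T-⌊⌋∧ (yes a) false = mk⇔ (λ ()) (λ ())
T-⌊⌋∧ (no ¬a) b     = mk⇔ (λ ()) (λ (a , _) → ¬a a)

Tournament : ∀ {ℓ} → Rel (Fin n) ℓ → Set ℓ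
Tournament _<_ = Asymmetric _<_ × (∀ {i j} → i ≢ j → i < j ⊎ j < i)

module EdgeCount {n} (G : SimpleGraph n) where
  open SimpleGraph G

  E? : B.Decidable (λ i j → adj i j ≡ true)
  E? i j = adj i j Bool.≟ true

  edgesOrientedBy : ∀ {ℓ} {_<_ : Rel (Fin n) ℓ} → B.Decidable _<_ → ℕ
  edgesOrientedBy _<?_ = sum (λ i → count (λ j → (i <? j) ×-dec E? i j))

  edgesOrientedBy-twice : ∀ {ℓ} {_<_ : Rel (Fin n) ℓ} (_<?_ : B.Decidable _<_) → Tournament _<_ →
    edgesOrientedBy _<?_ + edgesOrientedBy _<?_ ≡ sum (λ i → count (E? i))
  edgesOrientedBy-twice {_<_ = _<_} _<?_ (asym , connex) = begin
    sum (λ i → sum (λ j → ind i j)) + sum (λ i → sum (λ j → ind i j))  ≡⟨ cong (oriented +_) (∑-comm ind) ⟩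
    sum (λ i → sum (λ j → ind i j)) + sum (λ i → sum (λ j → ind j i))  ≡⟨ ∑-distrib-+ (sum ∘ ind) (λ i → sum (λ j → ind j i)) ⟨
    sum (λ i → sum (λ j → ind i j) + sum (λ j → ind j i))               ≡⟨ sum-cong-≗ (λ i → ∑-distrib-+ (ind i) (flip ind i)) ⟨
    sum (λ i → sum (λ j → ind i j + ind j i))                           ≡⟨ sum-cong-≗ (sum-cong-≗ ∘ either-way) ⟩
    sum (λ i → count (E? i))                                            ∎
    where
    open ≡-Reasoning
    ind : Fin n → Fin n → ℕ
    ind i j = if does ((i <? j) ×-dec E? i j) then 1 else 0
    oriented : ℕ
    oriented = sum (λ i → sum (ind i))
    edge : Fin n → Fin n → ℕ
    edge i j = if does (E? i j) then 1 else 0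
    either-way : ∀ i j → ind i j + ind j i ≡ edge i j
    either-way i j with i <? j | j <? i
    ... | yes i<j | yes j<i = ⊥-elim (asym i<j j<i)
    ... | yes _   | no  _   = ℕ.+-identityʳ (edge i j)
    ... | no  _   | yes _   = cong (λ b → if does (b Bool.≟ true) then 1 else 0) (adj-sym j i)
    ... | no i≮j  | no j≮i  with i Fin.≟ j
    ...   | yes refl = cong (λ b → if does (b Bool.≟ true) then 1 else 0) (sym (adj-irr i))
    ...   | no  i≢j  with connex i≢j
    ...     | inj₁ i<j = ⊥-elim (i≮j i<j)
    ...     | inj₂ j<i = ⊥-elim (j≮i j<i)

  edgesOrientedBy-invariant : ∀ {ℓ ℓ′} {_<_ : Rel (Fin n) ℓ} {_<′_ : Rel (Fin n) ℓ′}
    (_<?_ : B.Decidable _<_) (_<′?_ : B.Decidable _<′_) → Tournament _<_ → Tournament _<′_ →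
    edgesOrientedBy _<?_ ≡ edgesOrientedBy _<′?_
  edgesOrientedBy-invariant _<?_ _<′?_ t t′ = begin
    edgesOrientedBy _<?_                                   ≡⟨ ℕ.n≡⌊n+n/2⌋ _ ⟩
    ℕ.⌊ edgesOrientedBy _<?_ + edgesOrientedBy _<?_ /2⌋    ≡⟨ cong ℕ.⌊_/2⌋ (edgesOrientedBy-twice _<?_ t) ⟩
    ℕ.⌊ sum (λ i → count (E? i)) /2⌋                        ≡⟨ cong ℕ.⌊_/2⌋ (edgesOrientedBy-twice _<′?_ t′) ⟨
    ℕ.⌊ edgesOrientedBy _<′?_ + edgesOrientedBy _<′?_ /2⌋  ≡⟨ ℕ.n≡⌊n+n/2⌋ _ ⟨
    edgesOrientedBy _<′?_                                  ∎
    where open ≡-Reasoning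

  numEdges≡edgesOrientedBy-index : numEdges G ≡ edgesOrientedBy Fin._<?_
  numEdges≡edgesOrientedBy-index = begin
    numEdges G                                                     ≡⟨ length-filterᵇ-concatMap id row id ⟩
    sum (λ i → length (filterᵇ id (row i)))                 ≡⟨ sum-cong-≗ (λ i → cong (length ∘ filterᵇ id) (map-tabulate id (i <ᵇ_∧adj))) ⟩
    sum (λ i → length (filterᵇ id (tabulate (i <ᵇ_∧adj))))  ≡⟨ sum-cong-≗ (λ i → length-filterᵇ-tabulate id (i <ᵇ_∧adj)) ⟩
    sum (λ i → count (T? ∘ (i <ᵇ_∧adj)))                    ≡⟨ sum-cong-≗ (λ i → count-cong (T? ∘ (i <ᵇ_∧adj)) (λ j → (i Fin.<? j) ×-dec E? i j)
                                                                                         (≐-from-⇔ (index-order i))) ⟩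
    edgesOrientedBy Fin._<?_                                       ∎
    where
    open ≡-Reasoning
    _<ᵇ_∧adj : Fin n → Fin n → Bool
    (i <ᵇ j ∧adj) = ⌊ toℕ i ℕ.<? toℕ j ⌋ ∧ adj i j
    index-order : ∀ i {j} → T (i <ᵇ j ∧adj) ⇔ (toℕ i ℕ.< toℕ j × adj i j ≡ true)
    index-order i {j} = T-⌊⌋∧ (toℕ i ℕ.<? toℕ j) (adj i j)
    row : Fin n → List Bool
    row i = map (i <ᵇ_∧adj) (allFin n)

  numEdges≡∑-count-below : ∀ {ℓ} {_<_ : Rel (Fin n) ℓ} (_<?_ : B.Decidable _<_) → Tournament _<_ →
    numEdges G ≡ sum (λ v → count (λ u → (u <? v) ×-dec E? u v))
  numEdges≡∑-count-below _<?_ t = begin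
    numEdges G                  ≡⟨ numEdges≡edgesOrientedBy-index ⟩
    edgesOrientedBy Fin._<?_    ≡⟨ edgesOrientedBy-invariant Fin._<?_ _<?_ index-tournament t ⟩
    edgesOrientedBy _<?_        ≡⟨ ∑-comm (λ u v → if does ((u <? v) ×-dec E? u v) then 1 else 0) ⟩
    sum (λ v → count (λ u → (u <? v) ×-dec E? u v)) ∎
    where
    open ≡-Reasoning
    index-tournament : Tournament {n} (λ i j → toℕ i < toℕ j)
    index-tournament = Fin.<-asym , connex
      where
      connex : ∀ {i j} → i ≢ j → toℕ i < toℕ j ⊎ toℕ j < toℕ i
      connex {i} {j} i≢j with Fin.<-cmp i j
      ... | tri< i<j _ _ = inj₁ i<j
      ... | tri≈ _ i≡j _ = ⊥-elim (i≢j i≡j)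
      ... | tri> _ _ j<i = inj₂ j<i

-- Semi-bar representations

∧³-≡true : ∀ {A B C : Set} (a? : Dec A) (b? : Dec B) (c? : Dec C) →
           (⌊ a? ⌋ ∧ ⌊ b? ⌋ ∧ ⌊ c? ⌋ ≡ true) ⇔ (A × B × C)
∧³-≡true (yes a) (yes b) (yes c) = mk⇔ (λ _ → a , b , c) (λ _ → refl)
∧³-≡true (no ¬a) _       _       = mk⇔ (λ ()) (λ (a , _) → ⊥-elim (¬a a))
∧³-≡true (yes _) (no ¬b) _       = mk⇔ (λ ()) (λ (_ , b , _) → ⊥-elim (¬b b))
∧³-≡true (yes _) (yes _) (no ¬c) = mk⇔ (λ ()) (λ (_ , _ , c) → ⊥-elim (¬c c))

T-∧-not-not : ∀ {A C : Set} (b : Bool) (a? : Dec A) (c? : Dec C) →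
              T (b ∧ not ⌊ a? ⌋ ∧ not ⌊ c? ⌋) ⇔ (b ≡ true × ¬ A × ¬ C)
T-∧-not-not true  (no ¬a) (no ¬c) = mk⇔ (λ _ → refl , ¬a , ¬c) _
T-∧-not-not true  (no _)  (yes c) = mk⇔ (λ ()) (λ (_ , _ , ¬c) → ¬c c)
T-∧-not-not true  (yes a) _       = mk⇔ (λ ()) (λ (_ , ¬a , _) → ¬a a)
T-∧-not-not false _       _       = mk⇔ (λ ()) (λ ())

module _ {n} (R : SemiBarRep n) where
  open SemiBarRep R

  θ : Fin n → Angle
  θ v = record { value = angle v ; 0≤value = angle-nonneg v ; value<1 = angle-lt1 v }

  startAngle : Sightline → Angle
  startAngle s = record { value = Sightline.start s ; 0≤value = Sightline.start-nonneg s ; value<1 = Sightline.start-lt1 s }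

  hits⇔ : ∀ s w → (hits R s w ≡ true) ⇔
          (0ℚ ℚ.≤ Sightline.height s × Sightline.height s ℚ.≤ len w × offset (startAngle s) (θ w) ℚ.≤ Sightline.span s)
  hits⇔ s w rewrite onArc-offset (startAngle s) (θ w) (Sightline.span s) =
    ∧³-≡true (0ℚ ℚ.≤? Sightline.height s) (Sightline.height s ℚ.≤? len w)
             (offset (startAngle s) (θ w) ℚ.≤? Sightline.span s)

  Others : Sightline → Fin n → Fin n → Pred (Fin n) 0ℓ
  Others s a b w = hits R s w ≡ true × w ≢ a × w ≢ b

  others? : ∀ s a b → Decidable (Others s a b)
  others? s a b w = (hits R s w Bool.≟ true) ×-dec ¬? (w ≟ a) ×-dec ¬? (w ≟ b)

  othersHit≡count : ∀ s a b → othersHit R s a b ≡ count (others? s a b)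
  othersHit≡count s a b = trans (length-filterᵇ-tabulate othersᵇ id)
    (count-cong (T? ∘ othersᵇ) (others? s a b) (≐-from-⇔ (λ {w} → T-∧-not-not (hits R s w) (w ≟ a) (w ≟ b))))
    where
    othersᵇ : Fin n → Bool
    othersᵇ w = hits R s w ∧ not ⌊ w ≟ a ⌋ ∧ not ⌊ w ≟ b ⌋

  _≺_ : Rel (Fin n) 0ℓ
  _≺_ = ×-Lex _≡_ (flip ℚ._<_) ℕ._<_ on λ u → len u , toℕ u

  _≺?_ : B.Decidable _≺_
  _≺?_ = On.decidable _ _ (×-decidable ℚ._≟_ (flip ℚ._<?_) ℕ._<?_)

  ≺-isStrictPartialOrder : IsStrictPartialOrder _ _≺_
  ≺-isStrictPartialOrder = On.isStrictPartialOrder _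
    (×-isStrictPartialOrder (Flip.isStrictPartialOrder ℚ.<-isStrictPartialOrder) ℕ.<-isStrictPartialOrder)

  ≺-irrefl : ∀ {u} → ¬ u ≺ u
  ≺-irrefl = IsStrictPartialOrder.irrefl ≺-isStrictPartialOrder (IsStrictPartialOrder.Eq.refl ≺-isStrictPartialOrder)

  ≺⇒len≥ : ∀ {u v} → u ≺ v → len v ℚ.≤ len u
  ≺⇒len≥ (inj₁ v<u)      = ℚ.<⇒≤ v<u
  ≺⇒len≥ (inj₂ (u≡v , _)) = ℚ.≤-reflexive (sym u≡v)

  ≺-tournament : Tournament _≺_
  ≺-tournament = IsStrictPartialOrder.asym ≺-isStrictPartialOrder , connex
    where
    connex : ∀ {u v} → u ≢ v → u ≺ v ⊎ v ≺ u
    connex {u} {v} u≢v with ℚ.<-cmp (len u) (len v) | ℕ.<-cmp (toℕ u) (toℕ v)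
    ... | tri< u<v _ _ | _              = inj₂ (inj₁ u<v)
    ... | tri> _ _ v<u | _              = inj₁ (inj₁ v<u)
    ... | tri≈ _ u≡v _ | tri< i<j _ _   = inj₁ (inj₂ (u≡v , i<j))
    ... | tri≈ _ u≡v _ | tri> _ _ j<i   = inj₂ (inj₂ (sym u≡v , j<i))
    ... | tri≈ _ _ _   | tri≈ _ i≡j _   = ⊥-elim (u≢v (toℕ-injective i≡j))

  count-≤-othersHit : ∀ s a b {P : Pred (Fin n) 0ℓ} (P? : Decidable P) →
                      (∀ {w} → P w → Others s a b w) → count P? ≤ othersHit R s a b
  count-≤-othersHit s a b P? P⊆ = subst (count P? ≤_) (sym (othersHit≡count s a b)) (count-mono P? (others? s a b) P⊆)

  othersHit-≤-count : ∀ s a b {P : Pred (Fin n) 0ℓ} (P? : Decidable P) →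
                      (∀ {w} → Others s a b w → P w) → othersHit R s a b ≤ count P?
  othersHit-≤-count s a b P? ⊆P = subst (_≤ count P?) (sym (othersHit≡count s a b)) (count-mono (others? s a b) P? ⊆P)

  Sees-sym : ∀ {k a b} → Sees k R a b → Sees k R b a
  Sees-sym {a = a} {b} (s , ha , hb , few) =
    s , hb , ha , ℕ.≤-trans (othersHit-≤-count s b a (others? s a b) (λ (h , w≢b , w≢a) → h , w≢a , w≢b))
                            (subst (_≤ _) (othersHit≡count s a b) few)

  arcSightline : ℚ → Angle → Angle → Sightline
  arcSightline h x y = record
    { height = h ; start = value x ; span = offset x y
    ; start-nonneg = 0≤value x ; start-lt1 = value<1 x
    ; span-nonneg = offset-nonneg x y ; span-lt1 = offset<1 x y }

  angle-≢ : ∀ {u w} → u ≢ w → value (θ u) ≢ value (θ w)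
  angle-≢ u≢w eq = u≢w (angle-inj _ _ eq)

  module Around (k : ℕ) (v : Fin n) where

    -- w ⊏ u when w comes before u counterclockwise from v, so rank longer? u and
    -- corank longer? u count the longer bars strictly between v and u counterclockwise
    -- and clockwise.
    _⊏_ : Rel (Fin n) 0ℓ
    _⊏_ = ℚ._<_ on offset (θ v) ∘ θ

    _⊏?_ : B.Decidable _⊏_
    _⊏?_ = On.decidable _ _ ℚ._<?_

    ⊏-isStrictPartialOrder : IsStrictPartialOrder _ _⊏_
    ⊏-isStrictPartialOrder = On.isStrictPartialOrder _ ℚ.<-isStrictPartialOrder

    longer? : Decidable (_≺ v)
    longer? u = u ≺? v

    open Ranking ⊏-isStrictPartialOrder _⊏?_ public
    module Clockwise = Ranking (Flip.isStrictPartialOrder ⊏-isStrictPartialOrder) (flip _⊏?_)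

    ⊏-total : TotalOn (_≺ v)
    ⊏-total {w} {u} _ _ w≢u with ℚ.<-cmp (offset (θ v) (θ w)) (offset (θ v) (θ u))
    ... | tri< w⊏u _ _ = inj₁ w⊏u
    ... | tri≈ _ eq _  = ⊥-elim (w≢u (angle-inj w u (offset-injective (θ v) (θ w) (θ u) eq)))
    ... | tri> _ _ u⊏w = inj₂ u⊏w

    Visible : Fin n → Set
    Visible u = rank longer? u ≤ k ⊎ corank longer? u ≤ k

    visible? : Decidable Visible
    visible? u = (rank longer? u ℕ.≤? k) ⊎-dec (corank longer? u ℕ.≤? k)

    private
      ccw? cw? : Decidable (λ u → _)
      ccw? u = rank longer? u ℕ.≤? k
      cw?  u = corank longer? u ℕ.≤? k

      clockwise-total : Clockwise.TotalOn (_≺ v)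
      clockwise-total w≺v u≺v w≢u with ⊏-total w≺v u≺v w≢u
      ... | inj₁ w⊏u = inj₂ w⊏u
      ... | inj₂ u⊏w = inj₁ u⊏w

      count-ccw : count (longer? ∩? ccw?) ≡ count longer? ⊓ suc k
      count-ccw = trans (count-∩ longer? ccw?)
        (trans (sumOver-rank longer? ⊏-total _) (sumBelow-indicator-≤ k (count longer?)))

      count-cw : count (longer? ∩? cw?) ≡ count longer? ⊓ suc k
      count-cw = trans (count-∩ longer? cw?)
        (trans (Clockwise.sumOver-rank longer? clockwise-total _) (sumBelow-indicator-≤ k (count longer?)))

    count-visible : count (longer? ∩? visible?) ≡ count longer? ⊓ (2 * k + 2)
    count-visible with count longer? ℕ.<? 2 * k + 2
    ... | yes small = begin
      count (longer? ∩? visible?)   ≡⟨ count-cong (longer? ∩? visible?) longer? (proj₁ , λ u≺v → u≺v , all-visible u≺v) ⟩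
      count longer?                 ≡⟨ ℕ.m≤n⇒m⊓n≡m (ℕ.<⇒≤ small) ⟨
      count longer? ⊓ (2 * k + 2)   ∎
      where
      open ≡-Reasoning
      all-visible : ∀ {u} → u ≺ v → Visible u
      all-visible u≺v = m+n≤o+o⇒m≤o⊎n≤o k (ℕ.s≤s⁻¹ (ℕ.s≤s⁻¹
        (subst₂ _≤_ (cong suc (rank+corank longer? ⊏-total u≺v)) (2*k+2≡2+[k+k] k) small)))
    ... | no  large = begin
      count (longer? ∩? visible?)                     ≡⟨ count-cong (longer? ∩? visible?) (ccw-side ∪? cw-side) (distrib , undistrib) ⟩
      count (ccw-side ∪? cw-side)                     ≡⟨ count-∪-disjoint ccw-side cw-side not-both ⟩
      count ccw-side + count cw-side                  ≡⟨ cong₂ _+_ count-ccw count-cw ⟩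
      count longer? ⊓ suc k + count longer? ⊓ suc k   ≡⟨ cong₂ _+_ (ℕ.m≥n⇒m⊓n≡n k<N) (ℕ.m≥n⇒m⊓n≡n k<N) ⟩
      suc k + suc k                                   ≡⟨ 1+k+[1+k]≡2*k+2 k ⟩
      2 * k + 2                                       ≡⟨ ℕ.m≥n⇒m⊓n≡n (ℕ.≮⇒≥ large) ⟨
      count longer? ⊓ (2 * k + 2)                     ∎
      where
      open ≡-Reasoning
      ccw-side = longer? ∩? ccw?
      cw-side  = longer? ∩? cw?
      k<N : suc k ≤ count longer?
      k<N = ℕ.≤-trans (ℕ.m≤m+n (suc k) (suc k)) (subst (_≤ count longer?) (sym (1+k+[1+k]≡2*k+2 k)) (ℕ.≮⇒≥ large))
      distrib : ∀ {u} → u ≺ v × Visible u → (u ≺ v × _) ⊎ (u ≺ v × _)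
      distrib (u≺v , inj₁ ccw) = inj₁ (u≺v , ccw)
      distrib (u≺v , inj₂ cw)  = inj₂ (u≺v , cw)
      undistrib : ∀ {u} → (u ≺ v × _) ⊎ (u ≺ v × _) → u ≺ v × Visible u
      undistrib (inj₁ (u≺v , ccw)) = u≺v , inj₁ ccw
      undistrib (inj₂ (u≺v , cw))  = u≺v , inj₂ cw
      not-both : ∀ {u} → ¬ ((u ≺ v × rank longer? u ≤ k) × (u ≺ v × corank longer? u ≤ k))
      not-both ((u≺v , ccw) , (_ , cw)) = large
        (subst₂ _≤_ (cong suc (sym (rank+corank longer? ⊏-total u≺v))) (sym (2*k+2≡2+[k+k] k))
                (ℕ.s≤s (ℕ.s≤s (ℕ.+-mono-≤ ccw cw))))

    -- Whichever endpoint the arc of s reaches first, the arc covers every bar strictly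
    -- between the two in that direction.
    sees⇒visible : ∀ {u} → u ≺ v → Sees k R u v → Visible u
    sees⇒visible {u} u≺v (s , hu , hv , few)
      with 0≤h , _ , αu≤β ← to (hits⇔ s u) hu
      with _ , h≤Lv , αv≤β ← to (hits⇔ s v) hv
      with ℚ.≤-total (offset (startAngle s) (θ v)) (offset (startAngle s) (θ u))
    ... | inj₁ αv≤αu = inj₁ (ℕ.≤-trans (count-≤-othersHit s u v (λ w → longer? w ×-dec (w ⊏? u)) ccw-hit) few)
      where
      ccw-hit : ∀ {w} → w ≺ v × w ⊏ u → Others s u v w
      ccw-hit (w≺v , w⊏u) =
        from (hits⇔ s _) (0≤h , ℚ.≤-trans h≤Lv (≺⇒len≥ w≺v) ,
                           ℚ.≤-trans (offset-between (startAngle s) (θ v) (θ u) (θ _) αv≤αu (ℚ.<⇒≤ w⊏u)) αu≤β) ,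
        (λ { refl → ℚ.<-irrefl refl w⊏u }) , (λ { refl → ≺-irrefl w≺v })
    ... | inj₂ αu≤αv = inj₂ (ℕ.≤-trans (count-≤-othersHit s u v (λ w → longer? w ×-dec (u ⊏? w)) cw-hit) few)
      where
      cw-hit : ∀ {w} → w ≺ v × u ⊏ w → Others s u v w
      cw-hit (w≺v , u⊏w) =
        from (hits⇔ s _) (0≤h , ℚ.≤-trans h≤Lv (≺⇒len≥ w≺v) ,
                           ℚ.≤-trans (offset-between (startAngle s) (θ u) (θ v) (θ _) αu≤αv
                                       (ℚ.<⇒≤ (offset-rotate (θ v) (θ u) (θ _) (angle-≢ (λ { refl → ≺-irrefl u≺v })) u⊏w)))
                                     αv≤β) ,
        (λ { refl → ℚ.<-irrefl refl u⊏w }) , (λ { refl → ≺-irrefl w≺v })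

    module _ (len-injective : ∀ u w → len u ≡ len w → u ≡ w) where

      ≥len⇒≺ : ∀ {w} → len v ℚ.≤ len w → w ≢ v → w ≺ v
      ≥len⇒≺ v≤w w≢v = inj₁ (≤∧≢⇒< v≤w (λ eq → w≢v (sym (len-injective _ _ eq))))

      visible⇒sees : ∀ {u} → u ≺ v → Visible u → Sees k R u v
      visible⇒sees {u} u≺v (inj₁ ccw) =
        s , hit-u , hit-v , ℕ.≤-trans (othersHit-≤-count s u v (λ w → longer? w ×-dec (w ⊏? u)) inside) ccw
        where
        s = arcSightline (len v) (θ v) (θ u)
        hit-u = from (hits⇔ s u) (ℚ.<⇒≤ (len-pos v) , ≺⇒len≥ u≺v , ℚ.≤-refl)
        hit-v = from (hits⇔ s v) (ℚ.<⇒≤ (len-pos v) , ℚ.≤-refl ,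
                                  subst (ℚ._≤ offset (θ v) (θ u)) (sym (offset-self (θ v))) (offset-nonneg (θ v) (θ u)))
        inside : ∀ {w} → Others s u v w → w ≺ v × w ⊏ u
        inside {w} (hw , w≢u , w≢v) with _ , v≤w , vw≤vu ← to (hits⇔ s w) hw =
          ≥len⇒≺ v≤w w≢v , ≤∧≢⇒< vw≤vu (λ eq → w≢u (angle-inj w u (offset-injective (θ v) (θ w) (θ u) eq)))
      visible⇒sees {u} u≺v (inj₂ cw) =
        s , hit-u , hit-v , ℕ.≤-trans (othersHit-≤-count s u v (λ w → longer? w ×-dec (u ⊏? w)) inside) cw
        where
        s = arcSightline (len v) (θ u) (θ v)
        hit-u = from (hits⇔ s u) (ℚ.<⇒≤ (len-pos v) , ≺⇒len≥ u≺v ,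
                                  subst (ℚ._≤ offset (θ u) (θ v)) (sym (offset-self (θ u))) (offset-nonneg (θ u) (θ v)))
        hit-v = from (hits⇔ s v) (ℚ.<⇒≤ (len-pos v) , ℚ.≤-refl , ℚ.≤-refl)
        inside : ∀ {w} → Others s u v w → w ≺ v × u ⊏ w
        inside {w} (hw , w≢u , w≢v) with _ , v≤w , uw≤uv ← to (hits⇔ s w) hw =
          ≥len⇒≺ v≤w w≢v ,
          offset-rotate (θ w) (θ v) (θ u) (angle-≢ w≢v)
            (offset-rotate (θ u) (θ w) (θ v) (angle-≢ (λ { refl → w≢u refl }))
              (≤∧≢⇒< uw≤uv (λ eq → w≢v (angle-inj w v (offset-injective (θ u) (θ w) (θ v) eq)))))

  module _ (k : ℕ) where
    open Around k using (longer?; Visible; visible?; count-visible; sees⇒visible; visible⇒sees)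

    private
      ≺-asym = IsStrictPartialOrder.asym ≺-isStrictPartialOrder

      ∑-count-longer : sum (λ v → count (longer? v) ⊓ (2 * k + 2)) ≡ maxEdges k n
      ∑-count-longer = trans (sumOver-rank (λ _ → yes tt) (λ _ _ → proj₂ ≺-tournament) (_⊓ (2 * k + 2)))
                             (cong (λ N → sumBelow N (_⊓ (2 * k + 2))) (count-all {n = n}))
        where open Ranking ≺-isStrictPartialOrder _≺?_

    numEdges-≤ : (G : SimpleGraph n) →
                 (∀ a b → a ≢ b → SimpleGraph.adj G a b ≡ true → Sees k R a b) → numEdges G ≤ maxEdges k n
    numEdges-≤ G sees = begin
      numEdges G                                          ≡⟨ numEdges≡∑-count-below _≺?_ ≺-tournament ⟩
      sum (λ v → count (λ u → (u ≺? v) ×-dec E? u v))     ≤⟨ sum-mono-≤ (λ v → count-mono (λ u → (u ≺? v) ×-dec E? u v)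
                                                                                       (longer? v ∩? visible? v) (visible-edge v)) ⟩
      sum (λ v → count (longer? v ∩? visible? v))         ≡⟨ sum-cong-≗ count-visible ⟩
      sum (λ v → count (longer? v) ⊓ (2 * k + 2))         ≡⟨ ∑-count-longer ⟩
      maxEdges k n                                        ∎
      where
      open ℕ.≤-Reasoning
      open EdgeCount G
      visible-edge : ∀ v {u} → u ≺ v × SimpleGraph.adj G u v ≡ true → u ≺ v × Visible v u
      visible-edge v (u≺v , e) = u≺v , sees⇒visible v u≺v (sees _ v (λ { refl → ≺-irrefl u≺v }) e)

    module _ (len-injective : ∀ u w → len u ≡ len w → u ≡ w) where

      private
        Edge : Fin n → Fin n → Set
        Edge u v = (u ≺ v × Visible v u) ⊎ (v ≺ u × Visible u v)

        edge? : B.Decidable Edge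
        edge? u v = ((u ≺? v) ×-dec visible? v u) ⊎-dec ((v ≺? u) ×-dec visible? u v)

      visibilityGraph : SimpleGraph n
      visibilityGraph = record { adj = λ u v → ⌊ edge? u v ⌋ ; adj-sym = sym′ ; adj-irr = irr }
        where
        sym′ : ∀ u v → ⌊ edge? u v ⌋ ≡ ⌊ edge? v u ⌋
        sym′ u v with (u ≺? v) ×-dec visible? v u | (v ≺? u) ×-dec visible? u v
        ... | yes _ | yes _ = refl
        ... | yes _ | no  _ = refl
        ... | no  _ | yes _ = refl
        ... | no  _ | no  _ = refl
        irr : ∀ v → ⌊ edge? v v ⌋ ≡ false
        irr v with v ≺? v
        ... | yes v≺v = ⊥-elim (≺-irrefl v≺v)
        ... | no  _   = refl

      adj⇔Edge : ∀ {u v} → SimpleGraph.adj visibilityGraph u v ≡ true ⇔ Edge u v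
      adj⇔Edge {u} {v} = mk⇔ (λ e → toWitness (from T-≡ e)) (λ uv → to T-≡ (fromWitness uv))

      visibilityGraph-isCSBVis : IsCSBVisGraph k visibilityGraph
      visibilityGraph-isCSBVis = R , λ a b a≢b → mk⇔ (edge⇒sees ∘ to adj⇔Edge) (from adj⇔Edge ∘ sees⇒edge a≢b)
        where
        edge⇒sees : ∀ {a b} → Edge a b → Sees k R a b
        edge⇒sees (inj₁ (a≺b , vis)) = visible⇒sees _ len-injective a≺b vis
        edge⇒sees (inj₂ (b≺a , vis)) = Sees-sym (visible⇒sees _ len-injective b≺a vis)
        sees⇒edge : ∀ {a b} → a ≢ b → Sees k R a b → Edge a b
        sees⇒edge a≢b sab with proj₂ ≺-tournament a≢b
        ... | inj₁ a≺b = inj₁ (a≺b , sees⇒visible _ a≺b sab)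
        ... | inj₂ b≺a = inj₂ (b≺a , sees⇒visible _ b≺a (Sees-sym sab))

      numEdges-visibilityGraph : numEdges visibilityGraph ≡ maxEdges k n
      numEdges-visibilityGraph = begin
        numEdges visibilityGraph                         ≡⟨ numEdges≡∑-count-below _≺?_ ≺-tournament ⟩
        sum (λ v → count (λ u → (u ≺? v) ×-dec E? u v))  ≡⟨ sum-cong-≗ (λ v → count-cong (λ u → (u ≺? v) ×-dec E? u v)
                                                                                    (longer? v ∩? visible? v) (lower-edge , lower-visible)) ⟩
        sum (λ v → count (longer? v ∩? visible? v))      ≡⟨ sum-cong-≗ count-visible ⟩
        sum (λ v → count (longer? v) ⊓ (2 * k + 2))      ≡⟨ ∑-count-longer ⟩
        maxEdges k n                                     ∎
        where
        open ≡-Reasoning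
        open EdgeCount visibilityGraph
        lower-edge : ∀ {v u} → u ≺ v × SimpleGraph.adj visibilityGraph u v ≡ true → u ≺ v × Visible v u
        lower-edge (u≺v , e) with to adj⇔Edge e
        ... | inj₁ (_ , vis)   = u≺v , vis
        ... | inj₂ (v≺u , _)   = ⊥-elim (≺-asym u≺v v≺u)
        lower-visible : ∀ {v u} → u ≺ v × Visible v u → u ≺ v × SimpleGraph.adj visibilityGraph u v ≡ true
        lower-visible (u≺v , vis) = u≺v , from adj⇔Edge (inj₁ (u≺v , vis))

-- A representation with distinct lengths

spiral : ∀ n → SemiBarRep n
spiral n = record
  { angle        = halfway ∘ toℕ
  ; len          = λ i → 1ℚ ℚ.+ halfway (toℕ i)
  ; angle-nonneg = halfway-nonneg ∘ toℕ
  ; angle-lt1    = halfway<1 ∘ toℕ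
  ; angle-inj    = λ u v eq → toℕ-injective (halfway-injective _ _ eq)
  ; len-pos      = λ i → ℚ.<-≤-trans 0<1 (p≤p+q 1ℚ (halfway-nonneg (toℕ i)))
  }

spiral-len-injective : ∀ n (u v : Fin n) → SemiBarRep.len (spiral n) u ≡ SemiBarRep.len (spiral n) v → u ≡ v
spiral-len-injective n u v eq = toℕ-injective (halfway-injective _ _ (∙-cancelˡ 1ℚ _ _ eq))

maxEdges-isMax : ∀ k n {m} → maxEdges k n ≡ m → IsMaxEdges k n m
maxEdges-isMax k n eq =
  (λ G (R , G≅R) → subst (numEdges G ≤_) eq (numEdges-≤ R k G (λ a b a≢b → Equivalence.to (G≅R a b a≢b)))) ,
  (visibilityGraph (spiral n) k len-inj , visibilityGraph-isCSBVis (spiral n) k len-inj ,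
   trans (numEdges-visibilityGraph (spiral n) k len-inj) eq)
  where len-inj = spiral-len-injective n

corollary2 : (k n : ℕ) →
    (n ≥ 2 * k + 2 → IsMaxEdges k n ((k + 1) * (2 * n ∸ (2 * k + 3))))
    × (n ≤ 2 * k + 2 → IsMaxEdges k n (n C 2))
corollary2 k n = (λ n≥ → maxEdges-isMax k n (maxEdges-≥ k n n≥)) , (λ n≤ → maxEdges-isMax k n (maxEdges-≤ k n n≤))
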